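{- For every instance $I$ of fixed order scheduling with deadlines (with an arbitrary fixed order) such that $OPT(I)\le 2$, the first-fit algorithm satisfies $FF(I)\le \tfrac{3}{2}\,OPT(I)$.
   Context: Fixed order scheduling with deadlines: there are $n$ jobs $1,\dots,n$, job $j$ having processing time $p_j\in\mathbb{N}$, $p_j>0$, and deadline $d_j\in\mathbb{N}$ with $d_j\ge p_j$. All jobs are released at time $0$, and there are sufficiently many identical machines. Each machine processes its assigned jobs non-preemptively, without idle time, in increasing order of job index (this index order is the fixed order). A schedule is feasible if, for every job $j$, the total processing time of jobs $k\le j$ on the machine of $j$ is at most $d_j$. $OPT(I)$ is the minimum number of machines used (receiving at least one job) by a feasible schedule. The first-fit algorithm considers jobs in order $1,\dots,n$ and appends each job to the lowest-indexed open machine on which it would meet its deadline, opening a new machine if there is none; $FF(I)$ is the number of machines it opens. -}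

module Defs where

open import Data.Nat using (ℕ; zero; suc; _+_; _*_; _≤_; _<_; _≤?_)
open import Data.Fin using (Fin; toℕ) renaming (_≟_ to _≟ᶠ_)
open import Data.List using (List; []; _∷_; length; map; filter; foldl)
open import Data.Nat.ListAction using (sum)
open import Data.List using () renaming (allFin to allFinL)
open import Data.Product using (Σ; _×_; _,_)
open import Relation.Nullary.Decidable using (yes; no; _×-dec_)
open import Relation.Binary.PropositionalEquality using (_≡_)

-- An instance: n jobs indexed by Fin n (the index order is the fixed order),
-- processing times p and deadlines d.
record Instance : Set where
  field
    n   : ℕ
    p   : Fin n → ℕ
    d   : Fin n → ℕ
    p>0 : ∀ j → 0 < p j
    p≤d : ∀ j → p j ≤ d j
open Instance public

loadUpTo : (I : Instance) {m : ℕ} → (Fin (n I) → Fin m) → Fin (n I) → ℕ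
loadUpTo I σ j =
  sum (map (p I) (filter (λ k → (toℕ k ≤? toℕ j) ×-dec (σ k ≟ᶠ σ j)) (allFinL (n I))))

Feasible : (I : Instance) {m : ℕ} → (Fin (n I) → Fin m) → Set
Feasible I σ = ∀ j → loadUpTo I σ j ≤ d I j

-- Since a schedule
-- using exactly u machines can be relabelled into Fin u, this m is exactly
-- the minimum number of machines used.
IsOPT : Instance → ℕ → Set
IsOPT I m =
  Σ (Fin (n I) → Fin m) (λ σ → Feasible I σ) ×
  (∀ (k : ℕ) (τ : Fin (n I) → Fin k) → Feasible I τ → m ≤ k)

-- The state is the list of machine loads, in order of opening.
-- A job (p, d) goes onto the first machine with load l satisfying l + p ≤ d
-- (jobs are appended, so its completion time is l + p); otherwise a new
-- machine is opened.
place : ℕ → ℕ → List ℕ → List ℕ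
place pj dj [] = pj ∷ []
place pj dj (l ∷ ls) with l + pj ≤? dj
... | yes _ = (l + pj) ∷ ls
... | no  _ = l ∷ place pj dj ls

ffLoads : Instance → List ℕ
ffLoads I = foldl (λ ls j → place (p I j) (d I j) ls) [] (allFinL (n I))

FF : Instance → ℕ
FF I = length (ffLoads I)

-- Run first fit alongside a feasible schedule σ on two machines, whose loads
-- after a prefix of the jobs are a and b.  Invariant: the total first-fit load
-- is at most a + b, first fit has at most three machines, and if it has three
-- then its second or third is no heavier than a ⊓ b.  A job that σ puts on machine c
-- fits on any first-fit machine of load at most c, so the light machine
-- forbids a fourth one.  Every machine that first fit skips is heavier than c,
-- so once the first is skipped the other first-fit machines together are
-- lighter than the other machine c′ of σ; this keeps one of them below
-- (c + p) ⊓ c′ after the job is placed.  With one machine, first fit's only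
-- machine is never heavier than σ's, so the job always fits on it.
{-# OPTIONS --safe #-}
module Submission where

open import Data.Empty using (⊥)
open import Data.Fin using (Fin; zero; suc; toℕ) renaming (_≟_ to _≟ᶠ_)
open import Data.List using (List; []; _∷_; _++_; _∷ʳ_; length; map; filter; foldl) renaming (allFin to allFinL)
open import Data.List.Properties using (++-assoc; filter-++; filter-accept; map-++; foldl-∷ʳ)
open import Data.List.Relation.Unary.All using (All; []; _∷_; head)
open import Data.List.Relation.Unary.All.Properties using (++⁻ʳ)
open import Data.List.Relation.Unary.AllPairs using (AllPairs; []; _∷_)
open import Data.List.Relation.Unary.AllPairs.Properties using (tabulate⁺-<)
open import Data.Nat using (ℕ; zero; suc; _+_; _*_; _⊓_; _≤_; _<_; _≤?_; z≤n; s≤s)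
open import Data.Nat.ListAction using (sum)
open import Data.Nat.ListAction.Properties using (sum-++)
open import Data.Nat.Properties
open import Algebra.Properties.CommutativeSemigroup +-commutativeSemigroup using (xy∙z≈xz∙y)
open import Data.Product using (_×_; _,_)
open import Data.Sum using (_⊎_; inj₁; inj₂) renaming (map to map⊎; swap to swap⊎)
open import Data.Unit using (⊤; tt)
open import Data.Vec using (Vec; []; _∷_; lookup; replicate; _[_]%=_)
open import Data.Vec.Properties using (lookup∘updateAt; lookup∘updateAt′; lookup-replicate)
open import Function using (_∘_)
open import Relation.Binary using (Rel)
open import Relation.Binary.PropositionalEquality using (_≡_; refl; sym; trans; cong; cong₂; subst; module ≡-Reasoning)
open import Relation.Nullary using (¬_; yes; no; contradiction)
open import Relation.Nullary.Decidable using (_×-dec_)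
open import Relation.Unary using (Pred; Decidable)
open import Defs

allPairs⇒all-before : ∀ {a r} {A : Set a} {R : Rel A r} xs {y ys} →
                      AllPairs R (xs ++ y ∷ ys) → All (λ x → R x y) xs
allPairs⇒all-before []       _            = []
allPairs⇒all-before (x ∷ xs) (Rx ∷ pairs) = head (++⁻ʳ xs Rx) ∷ allPairs⇒all-before xs pairs

filter-×-dec : ∀ {a p q} {A : Set a} {P : Pred A p} {Q : Pred A q} (P? : Decidable P) (Q? : Decidable Q) {xs} →
               All P xs → filter (λ x → P? x ×-dec Q? x) xs ≡ filter Q? xs
filter-×-dec P? Q? []                      = refl
filter-×-dec P? Q? {x ∷ xs} (px ∷ pxs) with P? x | Q? x
... | yes _  | yes _ = cong (x ∷_) (filter-×-dec P? Q? pxs)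
... | yes _  | no  _ = filter-×-dec P? Q? pxs
... | no ¬px | _     = contradiction px ¬px

allFin-ascending : ∀ n → AllPairs (λ i j → toℕ i ≤ toℕ j) (allFinL n)
allFin-ascending n = tabulate⁺-< <⇒≤

sum-place : ∀ p d ls → sum (place p d ls) ≡ sum ls + p
sum-place p d []       = +-identityʳ p
sum-place p d (l ∷ ls) with l + p ≤? d
... | yes _ = xy∙z≈xz∙y l p (sum ls)
... | no  _ = trans (cong (l +_) (sum-place p d ls)) (sym (+-assoc l (sum ls) p))

-- ls are the loads of first fit and L the machine loads of a feasible schedule
-- on m machines, both after the same jobs.
record FirstFitInvariant (m k : ℕ) : Set₁ where
  field
    Holds   : List ℕ → Vec ℕ m → Set
    start   : Holds [] (replicate m 0)
    step    : ∀ {ls L} c pj dj → lookup L c + pj ≤ dj → Holds ls L →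
              Holds (place pj dj ls) (L [ c ]%= (_+ pj))
    bounded : ∀ {ls L} → Holds ls L → length ls ≤ k

module Simulation (I : Instance) {m : ℕ} (σ : Fin (n I) → Fin m) where

  Job : Set
  Job = Fin (n I)

  ffStep : List ℕ → Job → List ℕ
  ffStep ls j = place (p I j) (d I j) ls

  optStep : Vec ℕ m → Job → Vec ℕ m
  optStep L j = L [ σ j ]%= (_+ p I j)

  optLoads : List Job → Vec ℕ m
  optLoads = foldl optStep (replicate m 0)

  load : List Job → Fin m → ℕ
  load js c = sum (map (p I) (filter (λ k → σ k ≟ᶠ c) js))

  lookup-foldl-optStep : ∀ js L c → lookup (foldl optStep L js) c ≡ lookup L c + load js c
  lookup-foldl-optStep []       L c = sym (+-identityʳ (lookup L c))
  lookup-foldl-optStep (k ∷ js) L c with σ k ≟ᶠ c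
  ... | yes refl = begin
    lookup (foldl optStep (optStep L k) js) (σ k) ≡⟨ lookup-foldl-optStep js (optStep L k) (σ k) ⟩
    lookup (optStep L k) (σ k) + load js (σ k)    ≡⟨ cong (_+ load js (σ k)) (lookup∘updateAt (σ k) L) ⟩
    lookup L (σ k) + p I k + load js (σ k)        ≡⟨ +-assoc (lookup L (σ k)) (p I k) (load js (σ k)) ⟩
    lookup L (σ k) + (p I k + load js (σ k))      ∎
    where open ≡-Reasoning
  ... | no σk≢c = trans (lookup-foldl-optStep js (optStep L k) c)
                        (cong (_+ load js c) (lookup∘updateAt′ c (σ k) (σk≢c ∘ sym) L))

  load-before≤loadUpTo : ∀ pre j post → allFinL (n I) ≡ pre ++ j ∷ post →
                         load pre (σ j) + p I j ≤ loadUpTo I σ j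
  load-before≤loadUpTo pre j post allFin≡ = begin
    load pre (σ j) + p I j                ≤⟨ m≤m+n _ (total post) ⟩
    load pre (σ j) + p I j + total post   ≡⟨ +-assoc (load pre (σ j)) (p I j) (total post) ⟩
    load pre (σ j) + (p I j + total post) ≡⟨ cong₂ _+_ (cong (sum ∘ map (p I)) earlier)
                                                       (cong (sum ∘ map (p I)) current) ⟨
    total pre + total (j ∷ post)          ≡⟨ total-++ pre (j ∷ post) ⟨
    total (pre ++ j ∷ post)               ≡⟨ cong total allFin≡ ⟨
    loadUpTo I σ j                        ∎
    where
    open ≤-Reasoning
    sameMachineUpTo? : Decidable (λ k → toℕ k ≤ toℕ j × σ k ≡ σ j)
    sameMachineUpTo? k = (toℕ k ≤? toℕ j) ×-dec (σ k ≟ᶠ σ j)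
    total : List Job → ℕ
    total ks = sum (map (p I) (filter sameMachineUpTo? ks))
    total-++ : ∀ xs ys → total (xs ++ ys) ≡ total xs + total ys
    total-++ xs ys = begin-equality
      total (xs ++ ys)
        ≡⟨ cong (sum ∘ map (p I)) (filter-++ sameMachineUpTo? xs ys) ⟩
      sum (map (p I) (filter sameMachineUpTo? xs ++ filter sameMachineUpTo? ys))
        ≡⟨ cong sum (map-++ (p I) (filter sameMachineUpTo? xs) _) ⟩
      sum (map (p I) (filter sameMachineUpTo? xs) ++ map (p I) (filter sameMachineUpTo? ys))
        ≡⟨ sum-++ (map (p I) (filter sameMachineUpTo? xs)) _ ⟩
      total xs + total ys
        ∎
    earlier : filter sameMachineUpTo? pre ≡ filter (λ k → σ k ≟ᶠ σ j) pre
    earlier = filter-×-dec (λ k → toℕ k ≤? toℕ j) (λ k → σ k ≟ᶠ σ j)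
                (allPairs⇒all-before pre (subst (AllPairs _) allFin≡ (allFin-ascending (n I))))
    current : filter sameMachineUpTo? (j ∷ post) ≡ j ∷ filter sameMachineUpTo? post
    current = filter-accept sameMachineUpTo? (≤-refl , refl)

  Fits : Vec ℕ m → List Job → Set
  Fits L []       = ⊤
  Fits L (j ∷ js) = lookup L (σ j) + p I j ≤ d I j × Fits (optStep L j) js

  feasible⇒fits : Feasible I σ → ∀ pre js → allFinL (n I) ≡ pre ++ js → Fits (optLoads pre) js
  feasible⇒fits feasible pre []       _       = tt
  feasible⇒fits feasible pre (j ∷ js) allFin≡ = fits-j , fits-js
    where
    open ≤-Reasoning
    fits-j : lookup (optLoads pre) (σ j) + p I j ≤ d I j
    fits-j = begin
      lookup (optLoads pre) (σ j) + p I j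
        ≡⟨ cong (_+ p I j) (lookup-foldl-optStep pre (replicate m 0) (σ j)) ⟩
      lookup (replicate m 0) (σ j) + load pre (σ j) + p I j
        ≡⟨ cong (λ z → z + load pre (σ j) + p I j) (lookup-replicate (σ j) 0) ⟩
      load pre (σ j) + p I j
        ≤⟨ load-before≤loadUpTo pre j js allFin≡ ⟩
      loadUpTo I σ j
        ≤⟨ feasible j ⟩
      d I j
        ∎
    fits-js : Fits (optStep (optLoads pre) j) js
    fits-js = subst (λ L → Fits L js) (foldl-∷ʳ optStep (replicate m 0) j pre)
                (feasible⇒fits feasible (pre ∷ʳ j) js (trans allFin≡ (sym (++-assoc pre (j ∷ []) js))))

  simulate : ∀ {k} (Inv : FirstFitInvariant m k) js {ls L} → Fits L js → FirstFitInvariant.Holds Inv ls L →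
             FirstFitInvariant.Holds Inv (foldl ffStep ls js) (foldl optStep L js)
  simulate Inv []       _               holds = holds
  simulate Inv (j ∷ js) (fits-j , fits) holds =
    simulate Inv js fits (FirstFitInvariant.step Inv (σ j) (p I j) (d I j) fits-j holds)

FF≤ : ∀ {m k} → FirstFitInvariant m k → (I : Instance) (σ : Fin (n I) → Fin m) → Feasible I σ → FF I ≤ k
FF≤ Inv I σ feasible =
  bounded (simulate Inv (allFinL (n I)) (feasible⇒fits feasible [] (allFinL (n I)) refl) start)
  where
  open FirstFitInvariant Inv
  open Simulation I σ

SingleBelow : List ℕ → ℕ → Set
SingleBelow []          _ = ⊤
SingleBelow (x ∷ [])    a = x ≤ a
SingleBelow (_ ∷ _ ∷ _) _ = ⊥

singleBelow-place : ∀ ls {a p d} → SingleBelow ls a → a + p ≤ d → SingleBelow (place p d ls) (a + p)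
singleBelow-place []       {a} {p} _   _ = m≤n+m p a
singleBelow-place (x ∷ []) {p = p} {d} x≤a a+p≤d with x + p ≤? d
... | yes _    = +-monoˡ-≤ p x≤a
... | no x+p≰d = contradiction (≤-trans (+-monoˡ-≤ p x≤a) a+p≤d) x+p≰d
singleBelow-place (_ ∷ _ ∷ _) ()

singleBelow⇒length≤1 : ∀ ls {a} → SingleBelow ls a → length ls ≤ 1
singleBelow⇒length≤1 []          _ = z≤n
singleBelow⇒length≤1 (_ ∷ [])    _ = s≤s z≤n
singleBelow⇒length≤1 (_ ∷ _ ∷ _) ()

skipped⇒heavier : ∀ {l c p d} → ¬ (l + p ≤ d) → c + p ≤ d → c < l
skipped⇒heavier {p = p} l+p≰d c+p≤d = ≰⇒> (λ l≤c → l+p≰d (≤-trans (+-monoˡ-≤ p l≤c) c+p≤d))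

m+n≤o+q⇒o<m⇒n<q : ∀ {m n o q} → m + n ≤ o + q → o < m → n < q
m+n≤o+q⇒o<m⇒n<q {n = n} {o} {q} m+n≤o+q o<m =
  +-cancelˡ-< o n q (<-≤-trans (+-monoˡ-< n o<m) m+n≤o+q)

-- If u + p overshoots c′ then v < p, because u + v < c′.
relieve : ∀ {u v c c′} p → u ≤ c → u + v < c′ → u + p ≤ (c + p) ⊓ c′ ⊎ v ≤ (c + p) ⊓ c′
relieve {u} {v} {c} {c′} p u≤c u+v<c′ with u + p ≤? c′
... | yes u+p≤c′ = inj₁ (⊓-glb (+-monoˡ-≤ p u≤c) u+p≤c′)
... | no  u+p≰c′ = inj₂ (⊓-glb (≤-trans (<⇒≤ v<p) (m≤n+m p c)) (<⇒≤ (≤-<-trans (m≤n+m v u) u+v<c′)))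
  where
  v<p : v < p
  v<p = +-cancelˡ-< u v p (<-trans u+v<c′ (≰⇒> u+p≰c′))

LightTail : List ℕ → ℕ → Set
LightTail (y ∷ z ∷ [])    lo = y ≤ lo ⊎ z ≤ lo
LightTail (_ ∷ _ ∷ _ ∷ _) _  = ⊥
LightTail _               _  = ⊤

Light : List ℕ → ℕ → Set
Light []         _  = ⊤
Light (_ ∷ rest) lo = LightTail rest lo

lightTail-mono : ∀ rest {lo lo′} → lo ≤ lo′ → LightTail rest lo → LightTail rest lo′
lightTail-mono []              _      _     = tt
lightTail-mono (_ ∷ [])        _      _     = tt
lightTail-mono (_ ∷ _ ∷ [])    lo≤lo′ light = map⊎ (λ y≤lo → ≤-trans y≤lo lo≤lo′) (λ z≤lo → ≤-trans z≤lo lo≤lo′) light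
lightTail-mono (_ ∷ _ ∷ _ ∷ _) _      ()

lightPair-place : ∀ {y z c c′ p d} → y + z < c′ → y ≤ c ⊓ c′ ⊎ z ≤ c ⊓ c′ → c + p ≤ d →
                  LightTail (place p d (y ∷ z ∷ [])) ((c + p) ⊓ c′)
lightPair-place {y} {z} {c} {c′} {p} {d} y+z<c′ light c+p≤d with y + p ≤? d | light
... | yes _    | inj₁ y≤lo = relieve p (≤-trans y≤lo (m⊓n≤m c c′)) y+z<c′
... | yes _    | inj₂ z≤lo = inj₂ (≤-trans z≤lo (⊓-monoˡ-≤ c′ (m≤m+n c p)))
... | no y+p≰d | inj₁ y≤lo = contradiction (≤-trans y≤lo (m⊓n≤m c c′)) (<⇒≱ (skipped⇒heavier y+p≰d c+p≤d))
... | no _     | inj₂ z≤lo with z + p ≤? d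
...   | yes _    = swap⊎ (relieve p (≤-trans z≤lo (m⊓n≤m c c′)) (subst (_< c′) (+-comm y z) y+z<c′))
...   | no z+p≰d = contradiction (≤-trans z≤lo (m⊓n≤m c c′)) (<⇒≱ (skipped⇒heavier z+p≰d c+p≤d))

lightTail-place : ∀ rest {c c′ p d} → sum rest < c′ → LightTail rest (c ⊓ c′) → c + p ≤ d →
                  LightTail (place p d rest) ((c + p) ⊓ c′)
lightTail-place []       _ _ _ = tt
lightTail-place (y ∷ []) {p = p} {d} rest<c′ _ _ with y + p ≤? d
... | yes _ = tt
... | no  _ = swap⊎ (relieve p z≤n (subst (_< _) (+-identityʳ y) rest<c′))
lightTail-place (y ∷ z ∷ []) {c′ = c′} rest<c′ light c+p≤d =
  lightPair-place (subst (λ s → y + s < c′) (+-identityʳ z) rest<c′) light c+p≤d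
lightTail-place (_ ∷ _ ∷ _ ∷ _) _ () _

light-place : ∀ ls {c c′ p d} → sum ls ≤ c + c′ → Light ls (c ⊓ c′) → c + p ≤ d →
              Light (place p d ls) ((c + p) ⊓ c′)
light-place []         _ _ _ = tt
light-place (x ∷ rest) {c} {c′} {p} {d} total light c+p≤d with x + p ≤? d
... | yes _    = lightTail-mono rest (⊓-monoˡ-≤ c′ (m≤m+n c p)) light
... | no x+p≰d = lightTail-place rest (m+n≤o+q⇒o<m⇒n<q total (skipped⇒heavier x+p≰d c+p≤d)) light c+p≤d

light⇒length≤3 : ∀ ls {lo} → Light ls lo → length ls ≤ 3
light⇒length≤3 []                  _ = z≤n
light⇒length≤3 (_ ∷ [])            _ = s≤s z≤n
light⇒length≤3 (_ ∷ _ ∷ [])        _ = s≤s (s≤s z≤n)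
light⇒length≤3 (_ ∷ _ ∷ _ ∷ [])    _ = s≤s (s≤s (s≤s z≤n))
light⇒length≤3 (_ ∷ _ ∷ _ ∷ _ ∷ _) ()

record Balanced (ls : List ℕ) (a b : ℕ) : Set where
  constructor balanced
  field
    total : sum ls ≤ a + b
    light : Light ls (a ⊓ b)

balanced-swap : ∀ {ls a b} → Balanced ls a b → Balanced ls b a
balanced-swap {ls} {a} {b} (balanced total light) =
  balanced (subst (sum ls ≤_) (+-comm a b) total) (subst (Light ls) (⊓-comm a b) light)

balanced-place : ∀ {ls c c′ p d} → Balanced ls c c′ → c + p ≤ d → Balanced (place p d ls) (c + p) c′
balanced-place {ls} {c} {c′} {p} {d} (balanced total light) c+p≤d =
  balanced total′ (light-place ls total light c+p≤d)
  where
  open ≤-Reasoning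
  total′ : sum (place p d ls) ≤ c + p + c′
  total′ = begin
    sum (place p d ls) ≡⟨ sum-place p d ls ⟩
    sum ls + p         ≤⟨ +-monoˡ-≤ p total ⟩
    c + c′ + p         ≡⟨ xy∙z≈xz∙y c c′ p ⟩
    c + p + c′         ∎

open FirstFitInvariant

noMachine : FirstFitInvariant 0 0
noMachine .Holds ls _   = ls ≡ []
noMachine .start        = refl
noMachine .step ()
noMachine .bounded refl = z≤n

oneMachine : FirstFitInvariant 1 1
oneMachine .Holds ls (a ∷ [])                      = SingleBelow ls a
oneMachine .start                                  = tt
oneMachine .step {ls} {_ ∷ []} zero _ _ fits holds = singleBelow-place ls holds fits
oneMachine .bounded {ls} {_ ∷ []}                  = singleBelow⇒length≤1 ls

twoMachines : FirstFitInvariant 2 3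
twoMachines .Holds ls (a ∷ b ∷ [])                           = Balanced ls a b
twoMachines .start                                           = balanced z≤n tt
twoMachines .step {L = _ ∷ _ ∷ []} zero       _ _ fits holds = balanced-place holds fits
twoMachines .step {L = _ ∷ _ ∷ []} (suc zero) _ _ fits holds = balanced-swap (balanced-place (balanced-swap holds) fits)
twoMachines .bounded {ls} {_ ∷ _ ∷ []} holds                 = light⇒length≤3 ls (Balanced.light holds)

theorem5 : (I : Instance) (m : ℕ) → IsOPT I m → m ≤ 2 → 2 * FF I ≤ 3 * m
theorem5 I 0 ((σ , feasible) , _) _ = *-monoʳ-≤ 2 (FF≤ noMachine I σ feasible)
theorem5 I 1 ((σ , feasible) , _) _ = ≤-trans (*-monoʳ-≤ 2 (FF≤ oneMachine I σ feasible)) (n≤1+n 2)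
theorem5 I 2 ((σ , feasible) , _) _ = *-monoʳ-≤ 2 (FF≤ twoMachines I σ feasible)
theorem5 I (suc (suc (suc _))) _ (s≤s (s≤s ()))
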